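{- Let $n\ge 18$ with $n\equiv 0\pmod 3$. Then there exists a $5$-uniform hypergraph $\mathcal{H}=(V,\mathcal{E})$ with $EI(\mathcal{H})=C_n$ and $|\mathcal{E}|=\frac{2n}{3}$ such that every hyperedge of $\mathcal{H}$ is a $(3,2)$-hyperedge.
   Context: Hypergraphs $\mathcal{H}=(V,\mathcal{E})$ have no multiple hyperedges; isolated vertices are allowed. $\mathcal{H}$ is $5$-uniform if every hyperedge has exactly $5$ elements. The edge intersection hypergraph of $\mathcal{H}$ is $EI(\mathcal{H})=(V,\mathcal{E}^{EI})$ with $\mathcal{E}^{EI}=\{e_1\cap e_2: e_1,e_2\in\mathcal{E},\ e_1\ne e_2,\ |e_1\cap e_2|\ge 2\}$. $C_n$ is the cycle with vertex set $\{1,\dots,n\}$ and edges $\{i,i+1\}$, $i=1,\dots,n$ (vertices taken mod $n$); "$EI(\mathcal{H})=C_n$" means $V=\{1,\dots,n\}$ and $\mathcal{E}^{EI}$ is exactly the edge set of $C_n$. For $e\in\mathcal{E}$, a $k$-section of $e$ is a sequence $(i,i+1,\dots,i+k-1)$ of cyclically consecutive vertices with $\{i,\dots,i+k-1\}\subseteq e$, $i-1\notin e$, $i+k\notin e$ (mod $n$). A hyperedge $e$ is an $(l_1,\dots,l_t)$-hyperedge ($l_1\ge\dots\ge l_t$) if $e$ is the disjoint union of exactly $t$ sections, of cardinalities $l_1,\dots,l_t$. -}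

module Defs where

open import Data.Nat using (ℕ; zero; suc; _+_; _∸_; _≤_; _<_; NonZero)
open import Data.Nat.DivMod using (_mod_)
open import Data.Fin using (Fin; toℕ)
open import Data.Fin.Subset using (Subset; _∈_; _∉_; _∩_; _∪_; ⁅_⁆; ∣_∣)
open import Data.List using (List; map; length)
open import Data.List.Membership.Propositional using () renaming (_∈_ to _∈ₗ_)
open import Data.List.Relation.Unary.All using (All)
open import Data.List.Relation.Unary.Any using (Any)
open import Data.List.Relation.Unary.AllPairs using (AllPairs)
open import Data.List.Relation.Unary.Unique.Propositional using (Unique)
open import Data.Product using (Σ; ∃; ∃-syntax; _×_; _,_; proj₁; proj₂)
open import Relation.Binary.PropositionalEquality using (_≡_; _≢_)
open import Relation.Nullary using (¬_)
open import Function.Bundles using (_⇔_)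

-- Vertices 1,…,n of the paper are represented by Fin n (vertex v ↦ v-1);
-- cyclic arithmetic is done modulo n.

shift : {n : ℕ} .{{_ : NonZero n}} → Fin n → ℕ → Fin n
shift {n} i j = (toℕ i + j) mod n

pred' : {n : ℕ} .{{_ : NonZero n}} → Fin n → Fin n
pred' {n} i = (toℕ i + (n ∸ 1)) mod n

record Hypergraph (n : ℕ) : Set where
  field
    edges  : List (Subset n)
    simple : Unique edges
open Hypergraph public

Uniform : {n : ℕ} → ℕ → Hypergraph n → Set
Uniform k H = All (λ e → ∣ e ∣ ≡ k) (edges H)

EIEdge : {n : ℕ} → Hypergraph n → Subset n → Set
EIEdge H S = ∃[ e₁ ] ∃[ e₂ ] (e₁ ∈ₗ edges H × e₂ ∈ₗ edges H × e₁ ≢ e₂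
                               × S ≡ e₁ ∩ e₂ × 2 ≤ ∣ S ∣)

CycleEdge : (n : ℕ) .{{_ : NonZero n}} → Subset n → Set
CycleEdge n S = ∃[ i ] (S ≡ ⁅ i ⁆ ∪ ⁅ shift i 1 ⁆)

EIisCycle : {n : ℕ} .{{_ : NonZero n}} → Hypergraph n → Set
EIisCycle {n} H = ∀ S → EIEdge H S ⇔ CycleEdge n S

IsSection : {n : ℕ} .{{_ : NonZero n}} → Subset n → Fin n → ℕ → Set
IsSection e i k =
  (1 ≤ k) × (∀ j → j < k → shift i j ∈ e) × (pred' i ∉ e) × (shift i k ∉ e)

InRun : {n : ℕ} .{{_ : NonZero n}} → Fin n → Fin n × ℕ → Set
InRun x (i , k) = ∃[ j ] (j < k × x ≡ shift i j)

-- e is an (l₁,…,l_t)-hyperedge: e is the disjoint union of exactly the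
-- sections listed in ss (given by start vertex and cardinality), whose
-- cardinalities are ls.
IsTypedHyperedge : {n : ℕ} .{{_ : NonZero n}} → Subset n → List ℕ → Set
IsTypedHyperedge {n} e ls =
  Σ (List (Fin n × ℕ)) λ ss →
      (map proj₂ ss ≡ ls)
    × All (λ s → IsSection e (proj₁ s) (proj₂ s)) ss
    × AllPairs (λ s t → ∀ x → ¬ (InRun x s × InRun x t)) ss
    × (∀ x → (x ∈ e) ⇔ Any (InRun x) ss)

module Submission where

-- For n = 3m take, for every k < m, the hyperedges {3k, 3k+1, 3k+2, 3k+6, 3k+7} and
-- {3k+1, 3k+2, 3k+3, 3k+11, 3k+12}, each a 3-section followed by a 2-section. All offsets lie
-- in [0, 12], so two hyperedges can only meet when their base points 3k and 3l are at most 12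
-- apart modulo n. For each of these finitely many relative positions the intersection is read
-- off a table: it is empty, a single vertex, or a pair {a, a+1}, and every residue of a mod 3
-- occurs, so every cycle edge {i, i+1} is an intersection. This argument is carried out for
-- n ≥ 27; for n = 21 and 24 the same hyperedges, and for n = 18 a period-6 family, are checked
-- by evaluation.

open import Defs
open import Data.Bool using (Bool; true; false)
import Data.Bool as Bool
open import Data.Empty using (⊥-elim)
open import Data.Fin using (Fin; toℕ; fromℕ<) renaming (zero to fzero; suc to fsuc)
import Data.Fin as Fin
open import Data.Fin.Properties using (toℕ-fromℕ<; toℕ-injective; toℕ<n)
open import Data.Fin.Subset using (Subset; _⊆_; _∈_; _∉_; _∩_; _∪_; ⁅_⁆; ∣_∣; ⊥; inside; outside)
open import Data.Fin.Subset.Properties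
  using ( ∪-identityˡ; ∪-identityʳ; ∩-comm; ∩-idem; ⊆-antisym; nonempty?; Empty-unique
        ; ∣⊥∣≡0; ∣⁅x⁆∣≡1; ∉⊥; x∈⁅x⁆; x∈⁅y⁆⇒x≡y; x∈p∪q⁺; x∈p∪q⁻; x∈p∩q⁺; x∈p∩q⁻ )
open import Data.List using (List; []; _∷_; map; filter; length; cartesianProduct; allFin; concatMap; upTo)
open import Data.List.Properties using (length-map; length-++; length-tabulate)
open import Data.List.Membership.Propositional using (find) renaming (_∈_ to _∈ₗ_; _∉_ to _∉ₗ_)
open import Data.List.Membership.Propositional.Properties
  using (∈-filter⁺; ∈-filter⁻; ∈-map⁺; ∈-map⁻; ∈-cartesianProduct⁺; ∈-allFin)
open import Data.List.Relation.Unary.All as All using (All; []; _∷_; lookup; all?)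
open import Data.List.Relation.Unary.All.Properties using (All¬⇒¬Any; map⁺)
open import Data.List.Relation.Unary.Any using (Any; here; there; any?; satisfied)
open import Data.List.Relation.Unary.AllPairs using ([]; _∷_; allPairs?)
open import Data.List.Relation.Unary.Unique.Propositional using (Unique)
import Data.List.Relation.Unary.Unique.Propositional.Properties as Unique
open import Data.Nat
  using ( ℕ; suc; _+_; _*_; _∸_; _≤_; _<_; z≤n; s≤s; s≤s⁻¹; _≟_; _≤?_; _<?_
        ; NonZero; >-nonZero; >-nonZero⁻¹; _%_; _/_ )
open import Data.Nat.DivMod
open import Data.Nat.Divisibility using (m%n≡0⇒n∣m)
open import Data.Nat.Properties
open import Data.Nat.Tactic.RingSolver using (solve-∀)
open import Data.List.Membership.DecPropositional _≟_ using (_∈?_)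
open import Data.Product using (∃-syntax; _×_; _,_; proj₁; proj₂)
open import Data.Product.Properties using (≡-dec)
open import Data.Sum using (_⊎_; inj₁; inj₂; [_,_]′)
open import Data.Unit using (tt)
import Data.Vec.Base as Vec
open Vec using ([]; _∷_)
import Data.Vec.Properties as Vec
open import Function using (_∘_; id)
open import Function.Bundles using (mk⇔)
open import Relation.Binary.Definitions using (DecidableEquality)
open import Relation.Binary.PropositionalEquality
open import Relation.Nullary using (¬_; Dec; yes; no; ¬?; _⊎-dec_; _×-dec_)
open import Relation.Nullary.Decidable using (True; toWitness)

length-cartesianProduct : ∀ {A B : Set} (xs : List A) (ys : List B) →
                          length (cartesianProduct xs ys) ≡ length xs * length ys
length-cartesianProduct []       ys = refl
length-cartesianProduct (x ∷ xs) ys =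
  trans (length-++ (map (x ,_) ys)) (cong₂ _+_ (length-map (x ,_) ys) (length-cartesianProduct xs ys))

∣⁅x⁆∪p∣≡1+∣p∣ : ∀ {n} {x : Fin n} {p : Subset n} → x ∉ p → ∣ ⁅ x ⁆ ∪ p ∣ ≡ suc ∣ p ∣
∣⁅x⁆∪p∣≡1+∣p∣ {x = fzero}  {inside  ∷ p} x∉p = ⊥-elim (x∉p Vec.here)
∣⁅x⁆∪p∣≡1+∣p∣ {x = fzero}  {outside ∷ p} x∉p = cong (suc ∘ ∣_∣) (∪-identityˡ p)
∣⁅x⁆∪p∣≡1+∣p∣ {x = fsuc x} {inside  ∷ p} x∉p = cong suc (∣⁅x⁆∪p∣≡1+∣p∣ (x∉p ∘ Vec.there))
∣⁅x⁆∪p∣≡1+∣p∣ {x = fsuc x} {outside ∷ p} x∉p = ∣⁅x⁆∪p∣≡1+∣p∣ (x∉p ∘ Vec.there)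

[m%n+k]%n≡[m+k]%n : ∀ m k n .{{_ : NonZero n}} → (m % n + k) % n ≡ (m + k) % n
[m%n+k]%n≡[m+k]%n m k n = begin
  (m % n + k) % n                ≡⟨ [m+kn]%n≡m%n (m % n + k) (m / n) n ⟨
  (m % n + k + m / n * n) % n    ≡⟨ cong (_% n) (rearrange (m % n) k (m / n * n)) ⟩
  (m % n + m / n * n + k) % n    ≡⟨ cong (λ x → (x + k) % n) (m≡m%n+[m/n]*n m n) ⟨
  (m + k) % n                    ∎
  where
  open ≡-Reasoning
  rearrange : ∀ a b c → a + b + c ≡ a + c + b
  rearrange = solve-∀

m<2n⇒m≡m%n⊎m≡m%n+n : ∀ {m n} .{{_ : NonZero n}} → m < 2 * n → m ≡ m % n ⊎ m ≡ m % n + n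
m<2n⇒m≡m%n⊎m≡m%n+n {m} {n} m<2n with m / n | m<n*o⇒m/o<n {m} {2} {n} m<2n | m≡m%n+[m/n]*n m n
... | 0 | _ | m≡ = inj₁ (trans m≡ (+-identityʳ (m % n)))
... | 1 | _ | m≡ = inj₂ (trans m≡ (cong (m % n +_) (+-identityʳ n)))
... | suc (suc _) | s≤s (s≤s ()) | _

m%n≡o%n⇒m≡o⊎m≡o+n⊎o≡m+n : ∀ {m o n} .{{_ : NonZero n}} → m < 2 * n → o < 2 * n →
                           m % n ≡ o % n → m ≡ o ⊎ m ≡ o + n ⊎ o ≡ m + n
m%n≡o%n⇒m≡o⊎m≡o+n⊎o≡m+n {m} {o} {n} m<2n o<2n eq
  with m<2n⇒m≡m%n⊎m≡m%n+n m<2n | m<2n⇒m≡m%n⊎m≡m%n+n o<2n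
... | inj₁ m≡ | inj₁ o≡ = inj₁ (trans m≡ (trans eq (sym o≡)))
... | inj₂ m≡ | inj₂ o≡ = inj₁ (trans m≡ (trans (cong (_+ n) eq) (sym o≡)))
... | inj₂ m≡ | inj₁ o≡ = inj₂ (inj₁ (trans m≡ (cong (_+ n) (trans eq (sym o≡)))))
... | inj₁ m≡ | inj₂ o≡ = inj₂ (inj₂ (trans o≡ (cong (_+ n) (trans (sym eq) (sym m≡)))))

[r+m]%n≡[r+o]%n⇒m≡o : ∀ {r m o n} .{{_ : NonZero n}} → r < n → m < n → o < n →
                      (r + m) % n ≡ (r + o) % n → m ≡ o
[r+m]%n≡[r+o]%n⇒m≡o {r} {m} {o} {n} r<n m<n o<n eq
  with m%n≡o%n⇒m≡o⊎m≡o+n⊎o≡m+n (r+<2n m<n) (r+<2n o<n) eq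
  where
  r+<2n : ∀ {x} → x < n → r + x < 2 * n
  r+<2n {x} x<n = subst (r + x <_) (cong (n +_) (sym (+-identityʳ n))) (+-mono-< r<n x<n)
... | inj₁ r+m≡r+o = +-cancelˡ-≡ r m o r+m≡r+o
... | inj₂ (inj₁ r+m≡r+o+n) =
  ⊥-elim (<⇒≱ m<n (subst (n ≤_) (sym (+-cancelˡ-≡ r m (o + n) (trans r+m≡r+o+n (+-assoc r o n)))) (m≤n+m n o)))
... | inj₂ (inj₂ r+o≡r+m+n) =
  ⊥-elim (<⇒≱ o<n (subst (n ≤_) (sym (+-cancelˡ-≡ r o (m + n) (trans r+o≡r+m+n (+-assoc r m n)))) (m≤n+m n m)))

module _ {n : ℕ} .{{_ : NonZero n}} where

  vertex : ℕ → Fin n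
  vertex a = a mod n

  toℕ-vertex : ∀ a → toℕ (vertex a) ≡ a % n
  toℕ-vertex a = toℕ-fromℕ< (m%n<n a n)

  %≡⇒vertex≡ : ∀ {a b} → a % n ≡ b % n → vertex a ≡ vertex b
  %≡⇒vertex≡ {a} {b} eq = toℕ-injective (trans (toℕ-vertex a) (trans eq (sym (toℕ-vertex b))))

  vertex≡⇒%≡ : ∀ {a b} → vertex a ≡ vertex b → a % n ≡ b % n
  vertex≡⇒%≡ {a} {b} eq = trans (sym (toℕ-vertex a)) (trans (cong toℕ eq) (toℕ-vertex b))

  vertex-toℕ : ∀ i → vertex (toℕ i) ≡ i
  vertex-toℕ i = toℕ-injective (trans (toℕ-vertex (toℕ i)) (m<n⇒m%n≡m (toℕ<n i)))

  vertex-+n : ∀ a → vertex (a + n) ≡ vertex a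
  vertex-+n a = %≡⇒vertex≡ ([m+n]%n≡m%n a n)

  shift-vertex : ∀ a j → shift (vertex a) j ≡ vertex (a + j)
  shift-vertex a j = %≡⇒vertex≡ (trans (cong (λ x → (x + j) % n) (toℕ-vertex a)) ([m%n+k]%n≡[m+k]%n a j n))

  shift-vertex-+ : ∀ c s j → shift (vertex (c + s)) j ≡ vertex (c + (s + j))
  shift-vertex-+ c s j = trans (shift-vertex (c + s) j) (cong vertex (+-assoc c s j))

  pred'-vertex-+suc : ∀ c s → pred' (vertex (c + suc s)) ≡ vertex (c + s)
  pred'-vertex-+suc c s = begin
    pred' (vertex (c + suc s))        ≡⟨ shift-vertex (c + suc s) (n ∸ 1) ⟩
    vertex (c + suc s + (n ∸ 1))      ≡⟨ cong vertex (+-assoc c (suc s) (n ∸ 1)) ⟩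
    vertex (c + suc (s + (n ∸ 1)))    ≡⟨ cong (λ x → vertex (c + x)) (+-suc s (n ∸ 1)) ⟨
    vertex (c + (s + (1 + (n ∸ 1))))  ≡⟨ cong (λ x → vertex (c + (s + x))) (m+[n∸m]≡n (>-nonZero⁻¹ n)) ⟩
    vertex (c + (s + n))              ≡⟨ cong vertex (+-assoc c s n) ⟨
    vertex (c + s + n)                ≡⟨ vertex-+n (c + s) ⟩
    vertex (c + s)                    ∎
    where open ≡-Reasoning

  vertex-+-cancelˡ : ∀ c {a b} → a < n → b < n → vertex (c + a) ≡ vertex (c + b) → a ≡ b
  vertex-+-cancelˡ c a<n b<n eq = [r+m]%n≡[r+o]%n⇒m≡o (m%n<n c n) a<n b<n
    (trans ([m%n+k]%n≡[m+k]%n c _ n) (trans (vertex≡⇒%≡ eq) (sym ([m%n+k]%n≡[m+k]%n c _ n))))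

  cycleEdge : Fin n → Subset n
  cycleEdge i = ⁅ i ⁆ ∪ ⁅ shift i 1 ⁆

  translate : ℕ → List ℕ → Subset n
  translate c []       = ⊥
  translate c (o ∷ os) = ⁅ vertex (c + o) ⁆ ∪ translate c os

  ∈-translate⁺ : ∀ {c o os} → o ∈ₗ os → vertex (c + o) ∈ translate c os
  ∈-translate⁺ {os = _ ∷ _} (here refl) = x∈p∪q⁺ (inj₁ (x∈⁅x⁆ _))
  ∈-translate⁺ {os = _ ∷ _} (there o∈os) = x∈p∪q⁺ (inj₂ (∈-translate⁺ o∈os))

  ∈-translate⁻ : ∀ {x} c os → x ∈ translate c os → ∃[ o ] (o ∈ₗ os × x ≡ vertex (c + o))
  ∈-translate⁻ c []       x∈ = ⊥-elim (∉⊥ x∈)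
  ∈-translate⁻ c (o ∷ os) x∈ with x∈p∪q⁻ ⁅ vertex (c + o) ⁆ (translate c os) x∈
  ... | inj₁ x∈⁅⁆ = o , here refl , x∈⁅y⁆⇒x≡y _ x∈⁅⁆
  ... | inj₂ x∈os = let o′ , o′∈os , x≡ = ∈-translate⁻ c os x∈os in o′ , there o′∈os , x≡

  vertex∈translate⁻ : ∀ c {t os} → t < n → All (_< n) os → vertex (c + t) ∈ translate c os → t ∈ₗ os
  vertex∈translate⁻ c t<n os<n t∈ with ∈-translate⁻ c _ t∈
  ... | o , o∈os , eq = subst (_∈ₗ _) (sym (vertex-+-cancelˡ c t<n (lookup os<n o∈os) eq)) o∈os

  translate-∩ : ∀ c {xs ys} → All (_< n) xs → All (_< n) ys →
                translate c xs ∩ translate c ys ≡ translate c (filter (_∈? ys) xs)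
  translate-∩ c {xs} {ys} xs<n ys<n = ⊆-antisym ⊆-filter filter-⊆
    where
    ⊆-filter : translate c xs ∩ translate c ys ⊆ translate c (filter (_∈? ys) xs)
    ⊆-filter x∈ with x∈p∩q⁻ (translate c xs) (translate c ys) x∈
    ... | x∈xs , x∈ys with ∈-translate⁻ c xs x∈xs
    ... | o , o∈xs , refl =
      ∈-translate⁺ (∈-filter⁺ (_∈? ys) o∈xs (vertex∈translate⁻ c (lookup xs<n o∈xs) ys<n x∈ys))
    filter-⊆ : translate c (filter (_∈? ys) xs) ⊆ translate c xs ∩ translate c ys
    filter-⊆ x∈ with ∈-translate⁻ c (filter (_∈? ys) xs) x∈
    ... | o , o∈ , refl = let o∈xs , o∈ys = ∈-filter⁻ (_∈? ys) {xs = xs} o∈ in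
      x∈p∩q⁺ (∈-translate⁺ o∈xs , ∈-translate⁺ o∈ys)

  ∣translate∣ : ∀ c {os} → All (_< n) os → Unique os → ∣ translate c os ∣ ≡ length os
  ∣translate∣ c []           []            = ∣⊥∣≡0 n
  ∣translate∣ c (o<n ∷ os<n) (o∉os ∷ os!) =
    trans (∣⁅x⁆∪p∣≡1+∣p∣ (All¬⇒¬Any o∉os ∘ vertex∈translate⁻ c o<n os<n))
          (cong suc (∣translate∣ c os<n os!))

  translate-+ : ∀ c t os → translate (c + t) os ≡ translate c (map (t +_) os)
  translate-+ c t []       = refl
  translate-+ c t (o ∷ os) = cong₂ _∪_ (cong (⁅_⁆ ∘ vertex) (+-assoc c t o)) (translate-+ c t os)

  translate-+n : ∀ c os → translate (c + n) os ≡ translate c os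
  translate-+n c []       = refl
  translate-+n c (o ∷ os) = cong₂ _∪_ (cong ⁅_⁆ vertex-c+n+o) (translate-+n c os)
    where
    vertex-c+n+o : vertex (c + n + o) ≡ vertex (c + o)
    vertex-c+n+o = trans (cong vertex (swap c n o)) (vertex-+n (c + o))
      where
      swap : ∀ x y z → x + y + z ≡ x + z + y
      swap = solve-∀

  translate-adjacent : ∀ c a → translate c (a ∷ suc a ∷ []) ≡ cycleEdge (vertex (c + a))
  translate-adjacent c a = cong (⁅ vertex (c + a) ⁆ ∪_) (trans (∪-identityʳ _) (cong ⁅_⁆ (sym shift-1)))
    where
    shift-1 : shift (vertex (c + a)) 1 ≡ vertex (c + suc a)
    shift-1 = trans (shift-vertex-+ c a 1) (cong (λ x → vertex (c + x)) (+-comm a 1))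

blocks₃₂ : ℕ → List ℕ
blocks₃₂ b = 0 ∷ 1 ∷ 2 ∷ 4 + b ∷ 5 + b ∷ []

∉-blocks₃₂ : ∀ {t} b → 2 < t → t < 4 + b ⊎ 5 + b < t → t ∉ₗ blocks₃₂ b
∉-blocks₃₂ b ()             _   (here refl)
∉-blocks₃₂ b (s≤s ())       _   (there (here refl))
∉-blocks₃₂ b (s≤s (s≤s ())) _   (there (there (here refl)))
∉-blocks₃₂ b _ gap (there (there (there (here refl)))) =
  [ <-irrefl refl , (λ lt → <⇒≱ lt (n≤1+n _)) ]′ gap
∉-blocks₃₂ b _ gap (there (there (there (there (here refl))))) =
  [ (λ lt → <⇒≱ lt (n≤1+n _)) , <-irrefl refl ]′ gap

module Blocks₃₂ {n : ℕ} .{{_ : NonZero n}} (c b : ℕ) (7+b≤n : 7 + b ≤ n) where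

  private
    e : Subset n
    e = translate c (blocks₃₂ b)

    start₃ start₂ : Fin n
    start₃ = vertex (c + 0)
    start₂ = vertex (c + (4 + b))

    runs : List (Fin n × ℕ)
    runs = (start₃ , 3) ∷ (start₂ , 2) ∷ []

    <n : ∀ {t} → t ≤ 6 + b → t < n
    <n t≤6+b = ≤-trans (s≤s t≤6+b) 7+b≤n

    5+b<n∸1 : 5 + b < n ∸ 1
    5+b<n∸1 = ∸-monoˡ-≤ 1 7+b≤n

    blocks<n : All (_< n) (blocks₃₂ b)
    blocks<n = <n z≤n ∷ <n (s≤s z≤n) ∷ <n (s≤s (s≤s z≤n))
             ∷ <n (+-monoˡ-≤ b (m≤m+n 4 2)) ∷ <n (+-monoˡ-≤ b (m≤m+n 5 1)) ∷ []

    ∉e : ∀ {t} → t < n → 2 < t → t < 4 + b ⊎ 5 + b < t → vertex (c + t) ∉ e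
    ∉e t<n 2<t gap = ∉-blocks₃₂ b 2<t gap ∘ vertex∈translate⁻ c t<n blocks<n

    members₃ : ∀ j → j < 3 → shift start₃ j ∈ e
    members₃ j j<3 = subst (_∈ e) (sym (shift-vertex-+ c 0 j)) (∈-translate⁺ (offset j j<3))
      where
      offset : ∀ j → j < 3 → j ∈ₗ blocks₃₂ b
      offset 0 _ = here refl
      offset 1 _ = there (here refl)
      offset 2 _ = there (there (here refl))
      offset (suc (suc (suc _))) (s≤s (s≤s (s≤s ())))

    members₂ : ∀ j → j < 2 → shift start₂ j ∈ e
    members₂ j j<2 = subst (_∈ e) (sym (shift-vertex-+ c (4 + b) j)) (∈-translate⁺ (offset j j<2))
      where
      offset : ∀ j → j < 2 → 4 + b + j ∈ₗ blocks₃₂ b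
      offset 0 _ = there (there (there (here (+-identityʳ (4 + b)))))
      offset 1 _ = there (there (there (there (here (+-comm (4 + b) 1)))))
      offset (suc (suc _)) (s≤s (s≤s ()))

    section₃ : IsSection e start₃ 3
    section₃ = s≤s z≤n , members₃ , before , after
      where
      before : pred' start₃ ∉ e
      before = ∉e (∸-monoʳ-< (s≤s z≤n) (>-nonZero⁻¹ n)) (≤-trans (m≤m+n 3 (3 + b)) 5+b<n∸1) (inj₂ 5+b<n∸1)
             ∘ subst (_∈ e) (shift-vertex-+ c 0 (n ∸ 1))
      after : shift start₃ 3 ∉ e
      after = ∉e (<n (m≤m+n 3 (3 + b))) ≤-refl (inj₁ (s≤s (s≤s (s≤s (s≤s z≤n)))))
            ∘ subst (_∈ e) (shift-vertex-+ c 0 3)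

    section₂ : IsSection e start₂ 2
    section₂ = s≤s z≤n , members₂ , before , after
      where
      before : pred' start₂ ∉ e
      before = ∉e (<n (+-monoˡ-≤ b (m≤m+n 3 3))) (s≤s (s≤s (s≤s z≤n))) (inj₁ ≤-refl)
             ∘ subst (_∈ e) (pred'-vertex-+suc c (3 + b))
      after : shift start₂ 2 ∉ e
      after = ∉e (<n ≤-refl) (s≤s (s≤s (s≤s z≤n))) (inj₂ ≤-refl)
            ∘ subst (_∈ e) (trans (shift-vertex-+ c (4 + b) 2) (cong (λ t → vertex (c + t)) (+-comm (4 + b) 2)))

    runs-disjoint : ∀ x → ¬ (InRun x (start₃ , 3) × InRun x (start₂ , 2))
    runs-disjoint x ((j , j<3 , x≡) , (j′ , j′<2 , x≡′)) =
      <⇒≢ (≤-trans j<3 (m≤m+n 3 (1 + b + j′))) j≡4+b+j′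
      where
      j≡4+b+j′ : j ≡ 4 + b + j′
      j≡4+b+j′ = vertex-+-cancelˡ c (<n (≤-trans (s≤s⁻¹ j<3) (m≤m+n 2 (4 + b))))
        (<n (≤-trans (+-monoʳ-≤ (4 + b) (s≤s⁻¹ j′<2)) (≤-trans (≤-reflexive (+-comm (4 + b) 1)) (n≤1+n _))))
        (trans (sym (shift-vertex-+ c 0 j)) (trans (sym x≡) (trans x≡′ (shift-vertex-+ c (4 + b) j′))))

    inRun : ∀ {x} s {k} j → j < k → x ≡ vertex (c + (s + j)) → InRun x (vertex (c + s) , k)
    inRun s j j<k x≡ = j , j<k , trans x≡ (sym (shift-vertex-+ c s j))

    covered-by-runs : ∀ {x} → x ∈ e → Any (InRun x) runs
    covered-by-runs x∈ with ∈-translate⁻ c (blocks₃₂ b) x∈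
    ... | _ , here refl , x≡                   = here (inRun 0 0 (s≤s z≤n) x≡)
    ... | _ , there (here refl) , x≡           = here (inRun 0 1 (s≤s (s≤s z≤n)) x≡)
    ... | _ , there (there (here refl)) , x≡   = here (inRun 0 2 (s≤s (s≤s (s≤s z≤n))) x≡)
    ... | _ , there (there (there (here refl))) , x≡ =
      there (here (inRun (4 + b) 0 (s≤s z≤n) (trans x≡ (cong (λ t → vertex (c + t)) (sym (+-identityʳ (4 + b)))))))
    ... | _ , there (there (there (there (here refl)))) , x≡ =
      there (here (inRun (4 + b) 1 (s≤s (s≤s z≤n)) (trans x≡ (cong (λ t → vertex (c + t)) (+-comm 1 (4 + b))))))

    runs-⊆ : ∀ {x} → Any (InRun x) runs → x ∈ e
    runs-⊆ (here (j , j<3 , refl))         = members₃ j j<3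
    runs-⊆ (there (here (j , j<2 , refl))) = members₂ j j<2

  translate-isTyped : IsTypedHyperedge (translate c (blocks₃₂ b)) (3 ∷ 2 ∷ [])
  translate-isTyped = runs , refl , section₃ ∷ section₂ ∷ [] , (runs-disjoint ∷ []) ∷ [] ∷ [] ,
                      λ x → mk⇔ covered-by-runs runs-⊆

offsets : Bool → List ℕ
offsets false = blocks₃₂ 2
offsets true  = map (1 +_) (blocks₃₂ 6)

offsets≤12 : ∀ t → All (_≤ 12) (offsets t)
offsets≤12 false = toWitness {a? = all? (_≤? 12) (offsets false)} tt
offsets≤12 true  = toWitness {a? = all? (_≤? 12) (offsets true)} tt

offsets-unique : ∀ t → Unique (offsets t)
offsets-unique false = toWitness {a? = allPairs? (λ x y → ¬? (x ≟ y)) (offsets false)} tt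
offsets-unique true  = toWitness {a? = allPairs? (λ x y → ¬? (x ≟ y)) (offsets true)} tt

-- The offsets shared by the edge of type t₁ at 3u and the edge of type t₂ at 3(u + d).
common : Bool → Bool → ℕ → List ℕ
common t₁ t₂ d = filter (_∈? map (3 * d +_) (offsets t₂)) (offsets t₁)

data ShortOrAdjacent : List ℕ → Set where
  none     : ShortOrAdjacent []
  single   : ∀ a → ShortOrAdjacent (a ∷ [])
  adjacent : ∀ a → ShortOrAdjacent (a ∷ suc a ∷ [])

common-shape : ∀ t₁ t₂ d → d ≤ 4 → ¬ (t₁ ≡ t₂ × d ≡ 0) → ShortOrAdjacent (common t₁ t₂ d)
common-shape false false 0 _ same = ⊥-elim (same (refl , refl))
common-shape false false 1 _ _    = none
common-shape false false 2 _ _    = adjacent 6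
common-shape false false 3 _ _    = none
common-shape false false 4 _ _    = none
common-shape false true  0 _ _    = adjacent 1
common-shape false true  1 _ _    = single 6
common-shape false true  2 _ _    = single 7
common-shape false true  3 _ _    = none
common-shape false true  4 _ _    = none
common-shape true  false 0 _ _    = adjacent 1
common-shape true  false 1 _ _    = single 3
common-shape true  false 2 _ _    = single 12
common-shape true  false 3 _ _    = single 11
common-shape true  false 4 _ _    = single 12
common-shape true  true  0 _ same = ⊥-elim (same (refl , refl))
common-shape true  true  1 _ _    = none
common-shape true  true  2 _ _    = none
common-shape true  true  3 _ _    = adjacent 11
common-shape true  true  4 _ _    = none
common-shape _ _ (suc (suc (suc (suc (suc _))))) (s≤s (s≤s (s≤s (s≤s ())))) _

distance≤4-ordered : ∀ {u v o o′} → u ≤ v → o ≤ 12 → 3 * u + o ≡ 3 * v + o′ →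
                     ∃[ d ] (d ≤ 4 × v ≡ u + d)
distance≤4-ordered {u} {v} {o} {o′} u≤v o≤12 eq = d , *-cancelˡ-≤ 3 3d≤12 , v≡u+d
  where
  d = v ∸ u
  v≡u+d : v ≡ u + d
  v≡u+d = sym (m+[n∸m]≡n u≤v)
  distrib : ∀ u d o′ → 3 * (u + d) + o′ ≡ 3 * u + (3 * d + o′)
  distrib = solve-∀
  o≡3d+o′ : o ≡ 3 * d + o′
  o≡3d+o′ = +-cancelˡ-≡ (3 * u) o (3 * d + o′)
              (trans eq (trans (cong (λ x → 3 * x + o′) v≡u+d) (distrib u d o′)))
  3d≤12 : 3 * d ≤ 12
  3d≤12 = ≤-trans (m≤m+n (3 * d) o′) (subst (_≤ 12) o≡3d+o′ o≤12)

distance≤4 : ∀ {u v o o′} → o ≤ 12 → o′ ≤ 12 → 3 * u + o ≡ 3 * v + o′ →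
             ∃[ d ] (d ≤ 4 × (v ≡ u + d ⊎ u ≡ v + d))
distance≤4 {u} {v} o≤12 o′≤12 eq with ≤-total u v
... | inj₁ u≤v = let d , d≤4 , v≡ = distance≤4-ordered u≤v o≤12 eq in d , d≤4 , inj₁ v≡
... | inj₂ v≤u = let d , d≤4 , u≡ = distance≤4-ordered v≤u o′≤12 (sym eq) in d , d≤4 , inj₂ u≡

Solution : (n : ℕ) .{{_ : NonZero n}} → Set
Solution n = ∃[ H ] (Uniform 5 H × EIisCycle H × length (edges H) ≡ (2 * n) / 3
                     × All (λ e → IsTypedHyperedge e (3 ∷ 2 ∷ [])) (edges H))

module _ {n : ℕ} .{{_ : NonZero n}} where

  CycleEdgeOrSmall : Subset n → Set
  CycleEdgeOrSmall S = CycleEdge n S ⊎ ∣ S ∣ ≤ 1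

  ∣cycleEdge∣≡2 : 2 ≤ n → ∀ i → ∣ cycleEdge i ∣ ≡ 2
  ∣cycleEdge∣≡2 2≤n i =
    trans (∣⁅x⁆∪p∣≡1+∣p∣ (i≢i+1 ∘ x∈⁅y⁆⇒x≡y (shift i 1))) (cong suc (∣⁅x⁆∣≡1 (shift i 1)))
    where
    i≢i+1 : i ≢ shift i 1
    i≢i+1 i≡i+1 = 0≢1 (vertex-+-cancelˡ (toℕ i) (>-nonZero⁻¹ n) 2≤n
                        (trans (cong vertex (+-identityʳ (toℕ i))) (trans (vertex-toℕ i) i≡i+1)))
      where
      0≢1 : 0 ≢ 1
      0≢1 ()

  cycleEdgeOrSmall⇒∣∣≤2 : 2 ≤ n → ∀ {S} → CycleEdgeOrSmall S → ∣ S ∣ ≤ 2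
  cycleEdgeOrSmall⇒∣∣≤2 2≤n (inj₁ (i , refl)) = ≤-reflexive (∣cycleEdge∣≡2 2≤n i)
  cycleEdgeOrSmall⇒∣∣≤2 2≤n (inj₂ ∣S∣≤1)      = m≤n⇒m≤1+n ∣S∣≤1

  translate-shape : ∀ c {L} → ShortOrAdjacent L → CycleEdgeOrSmall (translate c L)
  translate-shape c none         = inj₂ (subst (_≤ 1) (sym (∣⊥∣≡0 n)) z≤n)
  translate-shape c (single a)   =
    inj₂ (≤-reflexive (trans (cong ∣_∣ (∪-identityʳ ⁅ vertex (c + a) ⁆)) (∣⁅x⁆∣≡1 (vertex (c + a)))))
  translate-shape c (adjacent a) = inj₁ (vertex (c + a) , translate-adjacent c a)

-- Hyperedges of types type₁ and type₂ with base points 3u and 3(u + d) meet in {3u + a, 3u + a + 1}.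
record AdjacentMeet (r : ℕ) : Set where
  field
    type₁ type₂ : Bool
    d a : ℕ
    d≤4 : d ≤ 4
    common≡ : common type₁ type₂ d ≡ a ∷ suc a ∷ []
    a≡ : a ≡ 3 * d + r

adjacentMeet : ∀ r → r < 3 → AdjacentMeet r
adjacentMeet 0 _ = record { type₁ = false ; type₂ = false ; d = 2 ; a = 6
                          ; d≤4 = s≤s (s≤s z≤n) ; common≡ = refl ; a≡ = refl }
adjacentMeet 1 _ = record { type₁ = false ; type₂ = true ; d = 0 ; a = 1
                          ; d≤4 = z≤n ; common≡ = refl ; a≡ = refl }
adjacentMeet 2 _ = record { type₁ = true ; type₂ = true ; d = 3 ; a = 11
                          ; d≤4 = s≤s (s≤s (s≤s z≤n)) ; common≡ = refl ; a≡ = refl }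
adjacentMeet (suc (suc (suc _))) (s≤s (s≤s (s≤s ())))

-- n ≥ 27 keeps the shifted offsets 3d + o (d ≤ 4, o ≤ 12) below n, so translates intersect offset-wise.
module Construction (m : ℕ) (9≤m : 9 ≤ m) where

  n : ℕ
  n = 3 * m

  27≤n : 27 ≤ n
  27≤n = *-monoʳ-≤ 3 9≤m

  instance
    n≢0 : NonZero n
    n≢0 = >-nonZero (≤-trans (s≤s z≤n) 27≤n)

  Label : Set
  Label = Bool × Fin m

  edge : Label → Subset n
  edge (t , k) = translate (3 * toℕ k) (offsets t)

  ≤24⇒<n : ∀ {o} → o ≤ 24 → o < n
  ≤24⇒<n o≤24 = ≤-trans (s≤s o≤24) (≤-trans (m≤m+n 25 2) 27≤n)

  offsets<n : ∀ t → All (_< n) (offsets t)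
  offsets<n t = All.map (λ o≤12 → ≤24⇒<n (≤-trans o≤12 (m≤m+n 12 12))) (offsets≤12 t)

  shifted<n : ∀ {d} t → d ≤ 4 → All (_< n) (map (3 * d +_) (offsets t))
  shifted<n t d≤4 = map⁺ (All.map (λ o≤12 → ≤24⇒<n (+-mono-≤ (*-monoʳ-≤ 3 d≤4) o≤12)) (offsets≤12 t))

  ∣edge∣≡5 : ∀ ℓ → ∣ edge ℓ ∣ ≡ 5
  ∣edge∣≡5 (false , k) = ∣translate∣ (3 * toℕ k) (offsets<n false) (offsets-unique false)
  ∣edge∣≡5 (true  , k) = ∣translate∣ (3 * toℕ k) (offsets<n true) (offsets-unique true)

  edge-isTyped : ∀ ℓ → IsTypedHyperedge (edge ℓ) (3 ∷ 2 ∷ [])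
  edge-isTyped (false , k) = Blocks₃₂.translate-isTyped (3 * toℕ k) 2 (≤-trans (m≤m+n 9 18) 27≤n)
  edge-isTyped (true  , k) =
    subst (λ e → IsTypedHyperedge e (3 ∷ 2 ∷ [])) (translate-+ (3 * toℕ k) 1 (blocks₃₂ 6))
      (Blocks₃₂.translate-isTyped (3 * toℕ k + 1) 6 (≤-trans (m≤m+n 13 14) 27≤n))

  -- Since n = 3m, the base points 3u and 3k are the same vertex.
  Lift : Fin m → ℕ → Set
  Lift k u = u ≡ toℕ k ⊎ u ≡ toℕ k + m

  translate-lift : ∀ {k u} os → Lift k u → translate {n} (3 * u) os ≡ translate (3 * toℕ k) os
  translate-lift     os (inj₁ refl) = refl
  translate-lift {k} os (inj₂ refl) =
    trans (cong (λ c → translate c os) (*-distribˡ-+ 3 (toℕ k) m)) (translate-+n (3 * toℕ k) os)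

  vertex-lift : ∀ {k u} r → Lift k u → vertex {n} (3 * u + r) ≡ vertex (3 * toℕ k + r)
  vertex-lift     r (inj₁ refl) = refl
  vertex-lift {k} r (inj₂ refl) = trans (cong vertex (distrib (toℕ k) m r)) (vertex-+n (3 * toℕ k + r))
    where
    distrib : ∀ k m r → 3 * (k + m) + r ≡ 3 * k + r + 3 * m
    distrib = solve-∀

  lift-injective : ∀ {k l u} → Lift k u → Lift l u → k ≡ l
  lift-injective         (inj₁ refl) (inj₁ k≡l)   = toℕ-injective k≡l
  lift-injective {k} {l} (inj₁ refl) (inj₂ k≡l+m) =
    ⊥-elim (<⇒≱ (toℕ<n k) (subst (m ≤_) (sym k≡l+m) (m≤n+m m (toℕ l))))
  lift-injective {k} {l} (inj₂ refl) (inj₁ k+m≡l) =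
    ⊥-elim (<⇒≱ (toℕ<n l) (subst (m ≤_) k+m≡l (m≤n+m m (toℕ k))))
  lift-injective {k} {l} (inj₂ refl) (inj₂ k+m≡l+m) = toℕ-injective (+-cancelʳ-≡ m (toℕ k) (toℕ l) k+m≡l+m)

  edge-∩ : ∀ {t₁ t₂ k l u d} → Lift k u → Lift l (u + d) → d ≤ 4 →
           edge (t₁ , k) ∩ edge (t₂ , l) ≡ translate (3 * u) (common t₁ t₂ d)
  edge-∩ {t₁} {t₂} {k} {l} {u} {d} k↑u l↑u+d d≤4 = begin
    edge (t₁ , k) ∩ edge (t₂ , l)
      ≡⟨ cong₂ _∩_ (translate-lift (offsets t₁) k↑u) (translate-lift (offsets t₂) l↑u+d) ⟨
    translate (3 * u) (offsets t₁) ∩ translate (3 * (u + d)) (offsets t₂)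
      ≡⟨ cong (λ c → translate (3 * u) (offsets t₁) ∩ translate c (offsets t₂)) (*-distribˡ-+ 3 u d) ⟩
    translate (3 * u) (offsets t₁) ∩ translate (3 * u + 3 * d) (offsets t₂)
      ≡⟨ cong (translate (3 * u) (offsets t₁) ∩_) (translate-+ (3 * u) (3 * d) (offsets t₂)) ⟩
    translate (3 * u) (offsets t₁) ∩ translate (3 * u) (map (3 * d +_) (offsets t₂))
      ≡⟨ translate-∩ (3 * u) (offsets<n t₁) (shifted<n t₂ d≤4) ⟩
    translate (3 * u) (common t₁ t₂ d) ∎
    where open ≡-Reasoning

  Near : Fin m → Fin m → Set
  Near k l = ∃[ u ] ∃[ d ] (Lift k u × Lift l (u + d) × d ≤ 4)

  near : ∀ {k l u v o o′} → Lift k u → Lift l v → o ≤ 12 → o′ ≤ 12 →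
         3 * u + o ≡ 3 * v + o′ → Near k l ⊎ Near l k
  near {u = u} {v} k↑u l↑v o≤12 o′≤12 eq with distance≤4 {u} {v} o≤12 o′≤12 eq
  ... | d , d≤4 , inj₁ refl = inj₁ (_ , d , k↑u , l↑v , d≤4)
  ... | d , d≤4 , inj₂ refl = inj₂ (_ , d , l↑v , k↑u , d≤4)

  3k+o<2n : ∀ (k : Fin m) {o} → o ≤ 12 → 3 * toℕ k + o < 2 * n
  3k+o<2n k {o} o≤12 = subst (3 * toℕ k + o <_) (cong (n +_) (sym (+-identityʳ n)))
    (+-mono-<-≤ (*-monoʳ-< 3 (toℕ<n k)) (≤-trans o≤12 (≤-trans (m≤m+n 12 15) 27≤n)))

  wrap : ∀ l o′ → 3 * l + o′ + n ≡ 3 * (l + m) + o′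
  wrap l o′ = identity l o′ m
    where
    identity : ∀ l o′ m → 3 * l + o′ + 3 * m ≡ 3 * (l + m) + o′
    identity = solve-∀

  near-offsets : ∀ {k l o o′} → o ≤ 12 → o′ ≤ 12 →
                 vertex {n} (3 * toℕ k + o) ≡ vertex (3 * toℕ l + o′) → Near k l ⊎ Near l k
  near-offsets {k} {l} {o} {o′} o≤12 o′≤12 eq
    with m%n≡o%n⇒m≡o⊎m≡o+n⊎o≡m+n (3k+o<2n k o≤12) (3k+o<2n l o′≤12) (vertex≡⇒%≡ eq)
  ... | inj₁ eq′        = near (inj₁ refl) (inj₁ refl) o≤12 o′≤12 eq′
  ... | inj₂ (inj₁ eq′) = near (inj₁ refl) (inj₂ refl) o≤12 o′≤12 (trans eq′ (wrap (toℕ l) o′))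
  ... | inj₂ (inj₂ eq′) = near (inj₂ refl) (inj₁ refl) o≤12 o′≤12 (sym (trans eq′ (wrap (toℕ k) o)))

  common-vertex⇒near : ∀ {x t₁ t₂ k l} → x ∈ edge (t₁ , k) → x ∈ edge (t₂ , l) → Near k l ⊎ Near l k
  common-vertex⇒near {t₁ = t₁} {t₂} x∈₁ x∈₂
    with ∈-translate⁻ _ (offsets t₁) x∈₁ | ∈-translate⁻ _ (offsets t₂) x∈₂
  ... | o , o∈ , refl | o′ , o′∈ , x≡ =
    near-offsets (lookup (offsets≤12 t₁) o∈) (lookup (offsets≤12 t₂) o′∈) x≡

  ∩-shape-near : ∀ {t₁ t₂ k l} → (t₁ , k) ≢ (t₂ , l) → Near k l →
                 CycleEdgeOrSmall (edge (t₁ , k) ∩ edge (t₂ , l))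
  ∩-shape-near {t₁} {t₂} {k} {l} ℓ₁≢ℓ₂ (u , d , k↑u , l↑u+d , d≤4) =
    subst CycleEdgeOrSmall (sym (edge-∩ {t₁} {t₂} k↑u l↑u+d d≤4))
      (translate-shape (3 * u) (common-shape t₁ t₂ d d≤4 same-edge))
    where
    same-edge : ¬ (t₁ ≡ t₂ × d ≡ 0)
    same-edge (refl , refl) = ℓ₁≢ℓ₂ (cong (t₁ ,_) (lift-injective k↑u (subst (Lift l) (+-identityʳ u) l↑u+d)))

  ∩-shape : ∀ {ℓ₁ ℓ₂} → ℓ₁ ≢ ℓ₂ → CycleEdgeOrSmall (edge ℓ₁ ∩ edge ℓ₂)
  ∩-shape {ℓ₁@(t₁ , k)} {ℓ₂@(t₂ , l)} ℓ₁≢ℓ₂ with nonempty? (edge ℓ₁ ∩ edge ℓ₂)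
  ... | no empty =
    inj₂ (subst (λ S → ∣ S ∣ ≤ 1) (sym (Empty-unique empty)) (subst (_≤ 1) (sym (∣⊥∣≡0 n)) z≤n))
  ... | yes (x , x∈) with x∈p∩q⁻ (edge ℓ₁) (edge ℓ₂) x∈
  ...   | x∈₁ , x∈₂ with common-vertex⇒near {t₁ = t₁} {t₂} {k} {l} x∈₁ x∈₂
  ...     | inj₁ near = ∩-shape-near ℓ₁≢ℓ₂ near
  ...     | inj₂ near =
    subst CycleEdgeOrSmall (∩-comm (edge ℓ₂) (edge ℓ₁)) (∩-shape-near {t₂} {t₁} (ℓ₁≢ℓ₂ ∘ sym) near)

  edges-distinct : ∀ {ℓ₁ ℓ₂} → ∣ edge ℓ₁ ∩ edge ℓ₂ ∣ ≤ 2 → edge ℓ₁ ≢ edge ℓ₂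
  edges-distinct {ℓ₁} ∣∩∣≤2 eq = 5≰2 (subst (_≤ 2) ∣∩∣≡5 ∣∩∣≤2)
    where
    ∣∩∣≡5 : ∣ edge ℓ₁ ∩ _ ∣ ≡ 5
    ∣∩∣≡5 = trans (cong (λ e → ∣ edge ℓ₁ ∩ e ∣) (sym eq))
                  (trans (cong ∣_∣ (∩-idem (edge ℓ₁))) (∣edge∣≡5 ℓ₁))
    5≰2 : ¬ 5 ≤ 2
    5≰2 (s≤s (s≤s ()))

  2≤n : 2 ≤ n
  2≤n = ≤-trans (m≤m+n 2 25) 27≤n

  edge-injective : ∀ {ℓ₁ ℓ₂} → edge ℓ₁ ≡ edge ℓ₂ → ℓ₁ ≡ ℓ₂
  edge-injective {ℓ₁} {ℓ₂} eq with ≡-dec Bool._≟_ Fin._≟_ ℓ₁ ℓ₂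
  ... | yes ℓ₁≡ℓ₂ = ℓ₁≡ℓ₂
  ... | no ℓ₁≢ℓ₂ = ⊥-elim (edges-distinct {ℓ₁} {ℓ₂} (cycleEdgeOrSmall⇒∣∣≤2 2≤n (∩-shape ℓ₁≢ℓ₂)) eq)

  ∃-lift : ∀ d → d ≤ m → (q : Fin m) → ∃[ k ] Lift q (toℕ k + d)
  ∃-lift d d≤m q with d ≤? toℕ q
  ... | yes d≤q = fromℕ< (≤-<-trans (m∸n≤m (toℕ q) d) (toℕ<n q)) ,
                  inj₁ (trans (cong (_+ d) (toℕ-fromℕ< _)) (m∸n+n≡m d≤q))
  ... | no d≰q =
    let d≤q+m = ≤-trans d≤m (m≤n+m m (toℕ q))
        q+m∸d<m = +-cancelʳ-< d (toℕ q + m ∸ d) m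
                    (subst (_< m + d) (sym (m∸n+n≡m d≤q+m))
                      (subst (_< m + d) (+-comm m (toℕ q)) (+-monoʳ-< m (≰⇒> d≰q))))
    in fromℕ< q+m∸d<m , inj₂ (trans (cong (_+ d) (toℕ-fromℕ< q+m∸d<m)) (m∸n+n≡m d≤q+m))

  cycleEdge-isMeet : ∀ i → ∃[ ℓ₁ ] ∃[ ℓ₂ ] (edge ℓ₁ ∩ edge ℓ₂ ≡ cycleEdge i)
  cycleEdge-isMeet i = (type₁ , k) , (type₂ , q) , (begin
    edge (type₁ , k) ∩ edge (type₂ , q)      ≡⟨ edge-∩ {type₁} {type₂} (inj₁ refl) q↑k+d d≤4 ⟩
    translate (3 * toℕ k) (common type₁ type₂ d) ≡⟨ cong (translate (3 * toℕ k)) common≡ ⟩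
    translate (3 * toℕ k) (a ∷ suc a ∷ [])   ≡⟨ translate-adjacent (3 * toℕ k) a ⟩
    cycleEdge (vertex (3 * toℕ k + a))      ≡⟨ cong cycleEdge vertex≡i ⟩
    cycleEdge i                              ∎)
    where
    open ≡-Reasoning
    r = toℕ i % 3
    open AdjacentMeet (adjacentMeet r (m%n<n (toℕ i) 3))
    i≡ : toℕ i ≡ 3 * (toℕ i / 3) + r
    i≡ = trans (m≡m%n+[m/n]*n (toℕ i) 3) (trans (+-comm r _) (cong (_+ r) (*-comm (toℕ i / 3) 3)))
    q<m : toℕ i / 3 < m
    q<m = m<n*o⇒m/o<n {toℕ i} {m} {3} (subst (toℕ i <_) (*-comm 3 m) (toℕ<n i))
    q = fromℕ< q<m
    k = proj₁ (∃-lift d (≤-trans d≤4 (≤-trans (m≤m+n 4 5) 9≤m)) q)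
    q↑k+d = proj₂ (∃-lift d (≤-trans d≤4 (≤-trans (m≤m+n 4 5) 9≤m)) q)
    distrib : ∀ k d r → 3 * k + (3 * d + r) ≡ 3 * (k + d) + r
    distrib = solve-∀
    vertex≡i : vertex (3 * toℕ k + a) ≡ i
    vertex≡i = begin
      vertex (3 * toℕ k + a)            ≡⟨ cong (λ x → vertex (3 * toℕ k + x)) a≡ ⟩
      vertex (3 * toℕ k + (3 * d + r))  ≡⟨ cong vertex (distrib (toℕ k) d r) ⟩
      vertex (3 * (toℕ k + d) + r)      ≡⟨ vertex-lift r q↑k+d ⟩
      vertex (3 * toℕ q + r)            ≡⟨ cong (λ x → vertex (3 * x + r)) (toℕ-fromℕ< q<m) ⟩
      vertex (3 * (toℕ i / 3) + r)      ≡⟨ cong vertex i≡ ⟨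
      vertex (toℕ i)                    ≡⟨ vertex-toℕ i ⟩
      i                                 ∎

  labels : List Label
  labels = cartesianProduct (false ∷ true ∷ []) (allFin m)

  H : Hypergraph n
  H = record { edges  = map edge labels
             ; simple = Unique.map⁺ edge-injective
                          (Unique.cartesianProduct⁺ (((λ ()) ∷ []) ∷ [] ∷ []) (Unique.allFin⁺ m)) }

  edge∈H : ∀ ℓ → edge ℓ ∈ₗ edges H
  edge∈H (t , k) = ∈-map⁺ edge (∈-cartesianProduct⁺ (bool∈ t) (∈-allFin k))
    where
    bool∈ : ∀ t → t ∈ₗ false ∷ true ∷ []
    bool∈ false = here refl
    bool∈ true  = there (here refl)

  all-edges : ∀ {P : Subset n → Set} → (∀ ℓ → P (edge ℓ)) → All P (edges H)
  all-edges P-edge = map⁺ (All.tabulate (λ {ℓ} _ → P-edge ℓ))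

  EI-H : EIisCycle H
  EI-H S = mk⇔ meet⇒cycleEdge cycleEdge⇒meet
    where
    meet⇒cycleEdge : ∀ {S} → EIEdge H S → CycleEdge n S
    meet⇒cycleEdge (e₁ , e₂ , e₁∈ , e₂∈ , e₁≢e₂ , refl , 2≤∣S∣) with ∈-map⁻ edge e₁∈ | ∈-map⁻ edge e₂∈
    ... | ℓ₁ , _ , refl | ℓ₂ , _ , refl with ∩-shape {ℓ₁} {ℓ₂} (e₁≢e₂ ∘ cong edge)
    ...   | inj₁ S-isCycleEdge = S-isCycleEdge
    ...   | inj₂ ∣S∣≤1     = ⊥-elim (<⇒≱ 2≤∣S∣ ∣S∣≤1)
    cycleEdge⇒meet : ∀ {S} → CycleEdge n S → EIEdge H S
    cycleEdge⇒meet (i , refl) =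
      let ℓ₁ , ℓ₂ , meet≡ = cycleEdge-isMeet i
          ∣meet∣≡2 = trans (cong ∣_∣ meet≡) (∣cycleEdge∣≡2 2≤n i)
      in edge ℓ₁ , edge ℓ₂ , edge∈H ℓ₁ , edge∈H ℓ₂ , edges-distinct {ℓ₁} {ℓ₂} (≤-reflexive ∣meet∣≡2) ,
         sym meet≡ , ≤-reflexive (sym (∣cycleEdge∣≡2 2≤n i))

  length-H : length (edges H) ≡ (2 * n) / 3
  length-H = begin
    length (map edge labels)  ≡⟨ length-map edge labels ⟩
    length labels             ≡⟨ length-cartesianProduct (false ∷ true ∷ []) (allFin m) ⟩
    2 * length (allFin m)     ≡⟨ cong (2 *_) (length-tabulate {n = m} id) ⟩
    2 * m                     ≡⟨ m*n/n≡m (2 * m) 3 ⟨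
    2 * m * 3 / 3             ≡⟨ cong (_/ 3) (rearrange m) ⟩
    2 * n / 3                 ∎
    where
    open ≡-Reasoning
    rearrange : ∀ m → 2 * m * 3 ≡ 2 * (3 * m)
    rearrange = solve-∀

  solution : Solution n
  solution = H , all-edges ∣edge∣≡5 , EI-H , length-H , all-edges edge-isTyped

module _ {n : ℕ} .{{_ : NonZero n}} where

  infix 4 _≟ₛ_
  _≟ₛ_ : DecidableEquality (Subset n)
  _≟ₛ_ = Vec.≡-dec Bool._≟_

  MeetsAreCycleEdges : List (Subset n) → Set
  MeetsAreCycleEdges es = All (λ e₁ → All (λ e₂ →
    e₁ ≡ e₂ ⊎ ∣ e₁ ∩ e₂ ∣ < 2 ⊎ Any (λ i → e₁ ∩ e₂ ≡ cycleEdge i) (allFin n)) es) es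

  CycleEdgesAreMeets : List (Subset n) → Set
  CycleEdgesAreMeets es = All (λ i → Any (λ e₁ → Any (λ e₂ →
    e₁ ≢ e₂ × cycleEdge i ≡ e₁ ∩ e₂ × 2 ≤ ∣ cycleEdge i ∣) es) es) (allFin n)

  meetsAreCycleEdges? : ∀ es → Dec (MeetsAreCycleEdges es)
  meetsAreCycleEdges? es = all? (λ e₁ → all? (λ e₂ →
    e₁ ≟ₛ e₂ ⊎-dec ∣ e₁ ∩ e₂ ∣ <? 2 ⊎-dec any? (λ i → e₁ ∩ e₂ ≟ₛ cycleEdge i) (allFin n)) es) es

  cycleEdgesAreMeets? : ∀ es → Dec (CycleEdgesAreMeets es)
  cycleEdgesAreMeets? es = all? (λ i → any? (λ e₁ → any? (λ e₂ →
    ¬? (e₁ ≟ₛ e₂) ×-dec cycleEdge i ≟ₛ (e₁ ∩ e₂) ×-dec 2 ≤? ∣ cycleEdge i ∣) es) es) (allFin n)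

  EIisCycle-byChecks : (H : Hypergraph n) → MeetsAreCycleEdges (edges H) → CycleEdgesAreMeets (edges H) →
                       EIisCycle H
  EIisCycle-byChecks H meets covers S = mk⇔ meet⇒cycleEdge cycleEdge⇒meet
    where
    meet⇒cycleEdge : ∀ {S} → EIEdge H S → CycleEdge n S
    meet⇒cycleEdge (e₁ , e₂ , e₁∈ , e₂∈ , e₁≢e₂ , refl , 2≤∣S∣) with lookup (lookup meets e₁∈) e₂∈
    ... | inj₁ e₁≡e₂        = ⊥-elim (e₁≢e₂ e₁≡e₂)
    ... | inj₂ (inj₁ ∣S∣<2) = ⊥-elim (<⇒≱ ∣S∣<2 2≤∣S∣)
    ... | inj₂ (inj₂ cycle) = satisfied cycle
    cycleEdge⇒meet : ∀ {S} → CycleEdge n S → EIEdge H S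
    cycleEdge⇒meet (i , refl) with find (lookup covers (∈-allFin i))
    ... | e₁ , e₁∈ , meets₁ with find meets₁
    ...   | e₂ , e₂∈ , e₁≢e₂ , i≡ , 2≤ = e₁ , e₂ , e₁∈ , e₂∈ , e₁≢e₂ , i≡ , 2≤

  blockHyperedges : List (ℕ × ℕ) → List (Subset n)
  blockHyperedges = map (λ (c , b) → translate c (blocks₃₂ b))

  solution-byChecks : (pairs : List (ℕ × ℕ)) →
    let es = blockHyperedges pairs in
    True (allPairs? (λ e₁ e₂ → ¬? (e₁ ≟ₛ e₂)) es) → True (all? (λ e → ∣ e ∣ ≟ 5) es) →
    True (meetsAreCycleEdges? es) → True (cycleEdgesAreMeets? es) →
    True (all? (λ (_ , b) → 7 + b ≤? n) pairs) → length pairs ≡ (2 * n) / 3 → Solution n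
  solution-byChecks pairs unique uniform meets covers fits len =
    H , toWitness uniform , EIisCycle-byChecks H (toWitness meets) (toWitness covers) ,
    trans (length-map _ pairs) len , map⁺ (All.map (λ {(c , b)} → Blocks₃₂.translate-isTyped c b) (toWitness fits))
    where
    H : Hypergraph n
    H = record { edges = blockHyperedges pairs ; simple = toWitness unique }

periodic : ℕ → ℕ → List (ℕ × ℕ) → List (ℕ × ℕ)
periodic p r pairs = concatMap (λ j → map (λ (c , b) → p * j + c , b) pairs) (upTo r)

-- The period-3 family used for n ≥ 21 fails for n = 18.
solution₁₈ : Solution 18
solution₁₈ = solution-byChecks (periodic 6 3 ((0 , 1) ∷ (1 , 7) ∷ (3 , 7) ∷ (4 , 1) ∷ [])) _ _ _ _ _ refl

solution₂₁ : Solution 21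
solution₂₁ = solution-byChecks (periodic 3 7 ((0 , 2) ∷ (1 , 6) ∷ [])) _ _ _ _ _ refl

solution₂₄ : Solution 24
solution₂₄ = solution-byChecks (periodic 3 8 ((0 , 2) ∷ (1 , 6) ∷ [])) _ _ _ _ _ refl

solution : ∀ k → Solution (3 * (6 + k))
solution 0 = solution₁₈
solution 1 = solution₂₁
solution 2 = solution₂₄
solution (suc (suc (suc k))) = Construction.solution (9 + k) (m≤m+n 9 k)

lemma1 : (n : ℕ) .{{_ : NonZero n}} → 18 ≤ n → n % 3 ≡ 0 →
    ∃[ H ] (Uniform 5 H × EIisCycle H × length (edges H) ≡ (2 * n) / 3
            × All (λ e → IsTypedHyperedge e (3 ∷ 2 ∷ [])) (edges H))
lemma1 n 18≤n n%3≡0 = subst (λ n → .{{_ : NonZero n}} → Solution n) (sym n≡3[6+k]) (solution k)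
  where
  k = n / 3 ∸ 6
  n≡3[6+k] : n ≡ 3 * (6 + k)
  n≡3[6+k] = trans (sym (m*[n/m]≡n (m%n≡0⇒n∣m n 3 n%3≡0)))
                   (cong (3 *_) (sym (m+[n∸m]≡n (/-monoˡ-≤ 3 18≤n))))
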